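{- There exist constants $c>0$ and $\epsilon_0>0$ such that for every $\epsilon\in(0,\epsilon_0)$ there is an instance of the online (unweighted) \textsc{MaximumIndependentSet} problem on which every online algorithm that maintains at every time an independent set of size at least $(1-\epsilon)\,\mathrm{opt}$ has amortized migration factor at least $c/\epsilon$.
   Context: Online \textsc{MaximumIndependentSet} (dynamic, on arbitrary graphs): starting from the empty graph, at each time step one vertex arrives together with its edges to present vertices, or one present vertex departs together with its edges. The algorithm outputs an independent set $S_t$ of the current graph at each time without knowledge of the future, and $\mathrm{opt}$ is the current maximum independent set size. Every vertex has profit $1$. The migration potential of each step is $1$. The migration cost of changing $S_{t-1}$ to $S_t$ is $|S_{t-1}\triangle S_t|$, excluding the initial inclusion of a newly arrived vertex. The amortized migration factor is the maximum over $t$ of (total migration cost up to $t$)/(total migration potential up to $t$).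
   Formalization: The parameter ε ranges only over rationals in $(0,\epsilon_0)$, and the constants c and ε₀ are taken in ℚ. -}

module Defs where

open import Data.Nat using (ℕ; zero; suc; _≡ᵇ_; _≤_)
open import Data.Bool using (Bool; true; false; not; _∧_; _∨_)
open import Data.Bool.ListAction using (any)
open import Data.List using (List; []; _∷_; _++_; map; length; take; filterᵇ)
open import Data.List.Membership.Propositional using (_∈_; _∉_)
open import Data.List.Relation.Unary.All using (All)
open import Data.List.Relation.Unary.Unique.Propositional using (Unique)
open import Data.Product using (_×_; _,_; proj₁; proj₂)
open import Data.Unit using (⊤)
open import Data.Empty using (⊥)
open import Data.Integer using (+_)
open import Data.Rational using (ℚ; _/_)

-- Vertices are named by natural numbers.
-- An event: a vertex arrives together with the list of (present) vertices it
-- is adjacent to, or a present vertex departs (with all its edges).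
data Event : Set where
  arrive : ℕ → List ℕ → Event
  depart : ℕ → Event

-- An instance is a finite sequence of events; event number t (t ≥ 1) is the
-- (t-1)-th list element.
Instance : Set
Instance = List Event

record Graph : Set where
  constructor graph
  field
    verts : List ℕ
    edges : List (ℕ × ℕ)
open Graph public

emptyGraph : Graph
emptyGraph = graph [] []

applyEvent : Graph → Event → Graph
applyEvent (graph vs es) (arrive v ns) = graph (v ∷ vs) (map (λ u → (v , u)) ns ++ es)
applyEvent (graph vs es) (depart v) =
  graph (filterᵇ (λ u → not (u ≡ᵇ v)) vs)
        (filterᵇ (λ e → not ((proj₁ e ≡ᵇ v) ∨ (proj₂ e ≡ᵇ v))) es)

run : Graph → List Event → Graph
run g [] = g
run g (e ∷ es) = run (applyEvent g e) es

graphAt : Instance → ℕ → Graph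
graphAt I t = run emptyGraph (take t I)

ValidEvent : Graph → Event → Set
ValidEvent g (arrive v ns) = (v ∉ verts g) × All (_∈ verts g) ns
ValidEvent g (depart v) = v ∈ verts g

ValidFrom : Graph → List Event → Set
ValidFrom g [] = ⊤
ValidFrom g (e ∷ es) = ValidEvent g e × ValidFrom (applyEvent g e) es

ValidInstance : Instance → Set
ValidInstance I = ValidFrom emptyGraph I

IsIndependentSet : Graph → List ℕ → Set
IsIndependentSet g S =
  Unique S × All (_∈ verts g) S ×
  (∀ u v → u ∈ S → v ∈ S → (u , v) ∈ edges g → ⊥)

-- |S| ≥ (1 - ε) · opt(g), where opt is the maximum independent set size
-- (stated as: for every independent set S' of g, (1-ε)|S'| ≤ |S|).
toℚ : ℕ → ℚ
toℚ n = (+ n) / 1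

-- An online algorithm: maps the prefix of events seen so far to the
-- independent set it outputs after those events.
OnlineAlgorithm : Set
OnlineAlgorithm = List Event → List ℕ

outputAt : OnlineAlgorithm → Instance → ℕ → List ℕ
outputAt A I t = A (take t I)

memᵇ : ℕ → List ℕ → Bool
memᵇ x xs = any (λ y → x ≡ᵇ y) xs

arrivedIn : List Event → List ℕ
arrivedIn [] = []
arrivedIn (arrive v ns ∷ []) = v ∷ []
arrivedIn (depart v ∷ []) = []
arrivedIn (e ∷ e' ∷ es) = arrivedIn (e' ∷ es)

arrivedAt : Instance → ℕ → List ℕ
arrivedAt I t = arrivedIn (take t I)

-- Migration cost of step t ≥ 1: |S_{t-1} △ S_t|, not counting the
-- initial inclusion of the vertex newly arrived at step t.
migrationCost : OnlineAlgorithm → Instance → ℕ → ℕ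
migrationCost A I zero = 0
migrationCost A I (suc t) =
  length (filterᵇ (λ x → not (memᵇ x old)) old')
    Data.Nat.+ length (filterᵇ (λ x → not (memᵇ x new)) old)
  where
    old = outputAt A I t
    new = outputAt A I (suc t)
    old' = filterᵇ (λ x → not (memᵇ x (arrivedAt I (suc t)))) new

-- Total migration cost up to time t (steps 1..t); total migration
-- potential up to time t is t (each step has potential 1).
totalMigrationCost : OnlineAlgorithm → Instance → ℕ → ℕ
totalMigrationCost A I zero = 0
totalMigrationCost A I (suc t) = totalMigrationCost A I t Data.Nat.+ migrationCost A I (suc t)

-- Independent sets of the complete bipartite graph K_{n,k} lie on one side. If ε(n+1) < 1, then
-- (1-ε)|S'| ≤ |S| forces |S'| ≤ |S| for every independent S' with |S'| ≤ n+1, so on K_{n,n-1} the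
-- algorithm must hold the whole left side and on K_{n,n+1} a subset of the right side. The instance
-- builds K_{n,n-1} and then, n times, lets two right vertices arrive and leave again: each round trip
-- moves the solution to the other side and back, dropping at least 2n vertices. Hence after fewer
-- than 6n steps the migration cost is at least 2n², and n ≈ 1/ε (which is ≥ 2 when ε < 1/4) gives
-- an amortized migration factor of at least 1/(6ε).
module Submission where

open import Defs

-- A submodule, so that the ℕ operators opened in it do not clash with the ℚ operators of theorem20.
module Construction where
  open import Data.Bool using (Bool; true; false; not; T; _∨_)
  open import Data.Empty using (⊥-elim)
  open import Data.List using (List; []; _∷_; _++_; [_]; map; length; take; filterᵇ; upTo; applyUpTo)
  open import Data.List.Properties using (length-++; ++-assoc; length-upTo; length-applyUpTo; filter-all)
  open import Data.List.Membership.Propositional using (_∈_; _∉_; find)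
  open import Data.List.Membership.Propositional.Properties
    using (∈-∃++; ∈-++⁺ˡ; ∈-++⁺ʳ; ∈-++⁻; ∈-map⁺; ∈-map⁻; ∈-filter⁺; ∈-filter⁻;
           ∈-upTo⁺; ∈-upTo⁻; ∈-applyUpTo⁺; ∈-applyUpTo⁻)
  open import Data.List.Relation.Binary.Subset.Propositional using (_⊆_)
  open import Data.List.Relation.Unary.Any as Any using (here; there)
  open import Data.List.Relation.Unary.Any.Properties using (any⁻)
  open import Data.List.Relation.Unary.All as All using (All; []; all?)
  open import Data.List.Relation.Unary.All.Properties using (¬All⇒Any¬)
  open import Data.List.Relation.Unary.AllPairs using (_∷_)
  open import Data.List.Relation.Unary.Unique.Propositional using (Unique)
  open import Data.List.Relation.Unary.Unique.Propositional.Properties using (upTo⁺; applyUpTo⁺₁)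
  open import Data.Nat
  open import Data.Nat.Properties
  open import Data.Nat.Tactic.RingSolver using (solve-∀)
  open import Data.Nat.DivMod using (m/n*n≤m; m≡m%n+[m/n]*n; m%n<n)
  open import Data.Product using (Σ; _×_; _,_; proj₁; proj₂; map₁; map₂)
  open import Data.Sum using (_⊎_; inj₁; inj₂; swap)
  open import Data.Unit using (tt)
  open import Function using (_∘_; flip)
  open import Relation.Nullary using (¬_; yes; no)
  open import Relation.Nullary.Decidable using (T?)
  open import Relation.Binary.PropositionalEquality hiding ([_])

  Unique⇒length-mono : ∀ {xs ys : List ℕ} → Unique xs → xs ⊆ ys → length xs ≤ length ys
  Unique⇒length-mono {[]} _ _ = z≤n
  Unique⇒length-mono {x ∷ xs} (x∉xs ∷ uxs) xs⊆ys with ∈-∃++ (xs⊆ys (here refl))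
  ... | us , vs , refl = begin
    suc (length xs)             ≤⟨ s≤s (Unique⇒length-mono uxs xs⊆us++vs) ⟩
    suc (length (us ++ vs))     ≡⟨ cong suc (length-++ us) ⟩
    suc (length us + length vs) ≡⟨ +-suc (length us) (length vs) ⟨
    length us + length (x ∷ vs) ≡⟨ length-++ us ⟨
    length (us ++ x ∷ vs)       ∎
    where
      open ≤-Reasoning
      xs⊆us++vs : xs ⊆ us ++ vs
      xs⊆us++vs {z} z∈xs with ∈-++⁻ us (xs⊆ys (there z∈xs))
      ... | inj₁ z∈us = ∈-++⁺ˡ z∈us
      ... | inj₂ (here refl) = ⊥-elim (All.lookup x∉xs z∈xs refl)
      ... | inj₂ (there z∈vs) = ∈-++⁺ʳ us z∈vs

  take-++ : ∀ {A : Set} (xs ys : List A) k → take (length xs + k) (xs ++ ys) ≡ xs ++ take k ys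
  take-++ [] ys k = refl
  take-++ (x ∷ xs) ys k = cong (x ∷_) (take-++ xs ys k)

  length-++-[_] : ∀ {A : Set} (x : A) xs → length (xs ++ [ x ]) ≡ suc (length xs)
  length-++-[ x ] xs = trans (length-++ xs) (+-comm (length xs) 1)

  T-not⇒¬T : ∀ {b} → T (not b) → ¬ T b
  T-not⇒¬T {false} _ ()

  ¬T⇒T-not : ∀ {b} → ¬ T b → T (not b)
  ¬T⇒T-not {true} ¬t = ¬t tt
  ¬T⇒T-not {false} _ = tt

  T-not-∨⁻ : ∀ {a b} → T (not (a ∨ b)) → T (not a) × T (not b)
  T-not-∨⁻ {false} t = tt , t

  T-not-∨⁺ : ∀ {a b} → T (not a) → T (not b) → T (not (a ∨ b))
  T-not-∨⁺ {false} _ t = t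

  ≢⇒T-not-≡ᵇ : ∀ {u v} → u ≢ v → T (not (u ≡ᵇ v))
  ≢⇒T-not-≡ᵇ {u} {v} u≢v = ¬T⇒T-not (u≢v ∘ ≡ᵇ⇒≡ u v)

  T-not-≡ᵇ⇒≢ : ∀ {u v} → T (not (u ≡ᵇ v)) → u ≢ v
  T-not-≡ᵇ⇒≢ {u} t refl = T-not⇒¬T t (≡⇒≡ᵇ u u refl)

  ∈-filterᵇ⁺ : ∀ {A : Set} (p : A → Bool) {x xs} → x ∈ xs → T (p x) → x ∈ filterᵇ p xs
  ∈-filterᵇ⁺ p = ∈-filter⁺ (T? ∘ p)

  ∈-filterᵇ⁻ : ∀ {A : Set} (p : A → Bool) {x xs} → x ∈ filterᵇ p xs → x ∈ xs × T (p x)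
  ∈-filterᵇ⁻ p = ∈-filter⁻ (T? ∘ p)

  ∉⇒T-not-memᵇ : ∀ {x Z} → x ∉ Z → T (not (memᵇ x Z))
  ∉⇒T-not-memᵇ {x} {Z} x∉Z = ¬T⇒T-not (x∉Z ∘ Any.map (≡ᵇ⇒≡ x _) ∘ any⁻ _ Z)

  dropped : List ℕ → List ℕ → ℕ
  dropped X Z = length (filterᵇ (λ x → not (memᵇ x Z)) X)

  dropped-disjoint : ∀ {X Z} → (∀ {x} → x ∈ X → x ∉ Z) → dropped X Z ≡ length X
  dropped-disjoint {X} {Z} disjoint =
    cong length (filter-all (T? ∘ λ x → not (memᵇ x Z)) (All.tabulate (∉⇒T-not-memᵇ ∘ disjoint)))

  droppedAt : OnlineAlgorithm → Instance → ℕ → ℕ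
  droppedAt A I t = dropped (outputAt A I t) (outputAt A I (suc t))

  droppedAt≤migrationCost : ∀ A I t → droppedAt A I t ≤ migrationCost A I (suc t)
  droppedAt≤migrationCost A I t = m≤n+m _ _

  run-++ : ∀ g (xs ys : List Event) → run g (xs ++ ys) ≡ run (run g xs) ys
  run-++ g [] ys = refl
  run-++ g (e ∷ xs) ys = run-++ (applyEvent g e) xs ys

  graphAt-++ : ∀ xs ys i → graphAt (xs ++ ys) (i + length xs) ≡ run (run emptyGraph xs) (take i ys)
  graphAt-++ xs ys i = begin
    run emptyGraph (take (i + length xs) (xs ++ ys))
      ≡⟨ cong (λ t → run emptyGraph (take t (xs ++ ys))) (+-comm i (length xs)) ⟩
    run emptyGraph (take (length xs + i) (xs ++ ys))
      ≡⟨ cong (run emptyGraph) (take-++ xs ys i) ⟩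
    run emptyGraph (xs ++ take i ys)
      ≡⟨ run-++ emptyGraph xs (take i ys) ⟩
    run (run emptyGraph xs) (take i ys) ∎
    where open ≡-Reasoning

  record _⊢_↝_ (g : Graph) (es : List Event) (P : Graph → Set) : Set where
    constructor reaches
    field
      valid : ValidFrom g es
      reached : P (run g es)

  open _⊢_↝_

  ↝-++ : ∀ {g xs ys} {P Q : Graph → Set} →
    g ⊢ xs ↝ P → (∀ {h} → P h → h ⊢ ys ↝ Q) → g ⊢ xs ++ ys ↝ Q
  ↝-++ {xs = []} (reaches _ p) next = next p
  ↝-++ {xs = e ∷ xs} (reaches (valid-e , valid-xs) p) next with ↝-++ {xs = xs} (reaches valid-xs p) next
  ... | reaches valid-xs++ys q = reaches (valid-e , valid-xs++ys) q

  ↝-[_] : ∀ {g} e {Q : Graph → Set} → ValidEvent g e × Q (applyEvent g e) → g ⊢ [ e ] ↝ Q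
  ↝-[ e ] (valid-e , q) = reaches (valid-e , tt) q

  ∈-arrive-edges⁻ : ∀ g {w ns u v} → (u , v) ∈ edges (applyEvent g (arrive w ns)) →
    (u ≡ w × v ∈ ns) ⊎ (u , v) ∈ edges g
  ∈-arrive-edges⁻ (graph vs es) {w} {ns} e∈ with ∈-++⁻ (map (λ u → (w , u)) ns) e∈
  ... | inj₂ e∈es = inj₂ e∈es
  ... | inj₁ e∈new with ∈-map⁻ (λ u → (w , u)) e∈new
  ...   | v , v∈ns , refl = inj₁ (refl , v∈ns)

  ∈-arrive-edges⁺ˡ : ∀ g {w ns v} → v ∈ ns → (w , v) ∈ edges (applyEvent g (arrive w ns))
  ∈-arrive-edges⁺ˡ (graph vs es) {w} v∈ns = ∈-++⁺ˡ (∈-map⁺ (λ u → (w , u)) v∈ns)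

  ∈-arrive-edges⁺ʳ : ∀ g {w ns e} → e ∈ edges g → e ∈ edges (applyEvent g (arrive w ns))
  ∈-arrive-edges⁺ʳ (graph vs es) {w} {ns} = ∈-++⁺ʳ (map (λ u → (w , u)) ns)

  ∈-depart-verts⁻ : ∀ g {w v} → v ∈ verts (applyEvent g (depart w)) → v ∈ verts g × v ≢ w
  ∈-depart-verts⁻ (graph vs es) v∈ with ∈-filterᵇ⁻ _ v∈
  ... | v∈vs , t = v∈vs , T-not-≡ᵇ⇒≢ t

  ∈-depart-verts⁺ : ∀ g {w v} → v ∈ verts g → v ≢ w → v ∈ verts (applyEvent g (depart w))
  ∈-depart-verts⁺ (graph vs es) v∈vs v≢w = ∈-filterᵇ⁺ _ v∈vs (≢⇒T-not-≡ᵇ v≢w)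

  ∈-depart-edges⁻ : ∀ g {w u v} → (u , v) ∈ edges (applyEvent g (depart w)) →
    (u , v) ∈ edges g × u ≢ w
  ∈-depart-edges⁻ (graph vs es) e∈ with ∈-filterᵇ⁻ _ e∈
  ... | e∈es , t = e∈es , T-not-≡ᵇ⇒≢ (proj₁ (T-not-∨⁻ t))

  ∈-depart-edges⁺ : ∀ g {w u v} → (u , v) ∈ edges g → u ≢ w → v ≢ w →
    (u , v) ∈ edges (applyEvent g (depart w))
  ∈-depart-edges⁺ (graph vs es) e∈es u≢w v≢w =
    ∈-filterᵇ⁺ _ e∈es (T-not-∨⁺ (≢⇒T-not-≡ᵇ u≢w) (≢⇒T-not-≡ᵇ v≢w))

  Right : ℕ → ℕ → ℕ → Set
  Right n k u = n ≤ u × u < k + n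

  -- K_{n,k} on the vertices 0 … k+n-1. The bound is written k + n, not n + k, so that adding the
  -- next right vertex k + n yields the bound suc k + n definitionally.
  record Biclique (n k : ℕ) (g : Graph) : Set where
    field
      vertex⇒< : ∀ {v} → v ∈ verts g → v < k + n
      <⇒vertex : ∀ {v} → v < k + n → v ∈ verts g
      edge-sides : ∀ {u v} → (u , v) ∈ edges g → Right n k u × v < n
      right-left-edge : ∀ {u v} → Right n k u → v < n → (u , v) ∈ edges g

  open Biclique

  emptyGraph-biclique : Biclique 0 0 emptyGraph
  emptyGraph-biclique = record
    { vertex⇒< = λ ()
    ; <⇒vertex = λ ()
    ; edge-sides = λ ()
    ; right-left-edge = λ { (_ , ()) _ } }

  ¬Right-zero : ∀ {n u} → ¬ Right n 0 u
  ¬Right-zero (n≤u , u<n) = <⇒≱ u<n n≤u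

  arrive-left-biclique : ∀ {n g} → Biclique n 0 g →
    ValidEvent g (arrive n []) × Biclique (suc n) 0 (applyEvent g (arrive n []))
  arrive-left-biclique {n} {g} B = (<-irrefl refl ∘ vertex⇒< B , []) , record
    { vertex⇒< = λ { (here refl) → ≤-refl ; (there v∈) → m<n⇒m<1+n (vertex⇒< B v∈) }
    ; <⇒vertex = <⇒vertex′
    ; edge-sides = edge-sides′
    ; right-left-edge = λ u-right _ → ⊥-elim (¬Right-zero u-right) }
    where
      <⇒vertex′ : ∀ {v} → v < suc n → v ∈ verts (applyEvent g (arrive n []))
      <⇒vertex′ {v} v<1+n with v ≟ n
      ... | yes refl = here refl
      ... | no v≢n = there (<⇒vertex B (≤∧≢⇒< (s≤s⁻¹ v<1+n) v≢n))
      edge-sides′ : ∀ {u v} → (u , v) ∈ edges (applyEvent g (arrive n [])) → Right (suc n) 0 u × v < suc n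
      edge-sides′ e∈ with ∈-arrive-edges⁻ g {n} {[]} e∈
      ... | inj₁ (_ , ())
      ... | inj₂ e∈g = ⊥-elim (¬Right-zero (proj₁ (edge-sides B e∈g)))

  arrive-right-biclique : ∀ {n k g} → Biclique n k g →
    ValidEvent g (arrive (k + n) (upTo n)) × Biclique n (suc k) (applyEvent g (arrive (k + n) (upTo n)))
  arrive-right-biclique {n} {k} {g} B =
    (<-irrefl refl ∘ vertex⇒< B , All.tabulate (<⇒vertex B ∘ left<k+n ∘ ∈-upTo⁻)) , record
    { vertex⇒< = λ { (here refl) → ≤-refl ; (there v∈) → m<n⇒m<1+n (vertex⇒< B v∈) }
    ; <⇒vertex = <⇒vertex′
    ; edge-sides = edge-sides′
    ; right-left-edge = right-left-edge′ }
    where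
      left<k+n : ∀ {v} → v < n → v < k + n
      left<k+n v<n = ≤-trans v<n (m≤n+m n k)
      <⇒vertex′ : ∀ {v} → v < suc k + n → v ∈ verts (applyEvent g (arrive (k + n) (upTo n)))
      <⇒vertex′ {v} v<1+k+n with v ≟ k + n
      ... | yes refl = here refl
      ... | no v≢k+n = there (<⇒vertex B (≤∧≢⇒< (s≤s⁻¹ v<1+k+n) v≢k+n))
      edge-sides′ : ∀ {u v} → (u , v) ∈ edges (applyEvent g (arrive (k + n) (upTo n))) →
        Right n (suc k) u × v < n
      edge-sides′ e∈ with ∈-arrive-edges⁻ g e∈
      ... | inj₁ (refl , v∈) = (m≤n+m n k , ≤-refl) , ∈-upTo⁻ v∈
      ... | inj₂ e∈g with edge-sides B e∈g
      ...   | (n≤u , u<k+n) , v<n = (n≤u , m<n⇒m<1+n u<k+n) , v<n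
      right-left-edge′ : ∀ {u v} → Right n (suc k) u → v < n →
        (u , v) ∈ edges (applyEvent g (arrive (k + n) (upTo n)))
      right-left-edge′ {u} (n≤u , u<1+k+n) v<n with u ≟ k + n
      ... | yes refl = ∈-arrive-edges⁺ˡ g (∈-upTo⁺ v<n)
      ... | no u≢k+n = ∈-arrive-edges⁺ʳ g (right-left-edge B (n≤u , ≤∧≢⇒< (s≤s⁻¹ u<1+k+n) u≢k+n) v<n)

  depart-right-biclique : ∀ {n k g} → Biclique n (suc k) g →
    ValidEvent g (depart (k + n)) × Biclique n k (applyEvent g (depart (k + n)))
  depart-right-biclique {n} {k} {g} B = <⇒vertex B ≤-refl , record
    { vertex⇒< = λ v∈ → let v∈g , v≢k+n = ∈-depart-verts⁻ g v∈ in below-k+n (vertex⇒< B v∈g) v≢k+n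
    ; <⇒vertex = λ v<k+n → ∈-depart-verts⁺ g (<⇒vertex B (m<n⇒m<1+n v<k+n)) (<⇒≢ v<k+n)
    ; edge-sides = edge-sides′
    ; right-left-edge = λ { (n≤u , u<k+n) v<n →
        ∈-depart-edges⁺ g (right-left-edge B (n≤u , m<n⇒m<1+n u<k+n) v<n)
          (<⇒≢ u<k+n) (<⇒≢ (left<k+n v<n)) } }
    where
      left<k+n : ∀ {v} → v < n → v < k + n
      left<k+n v<n = ≤-trans v<n (m≤n+m n k)
      below-k+n : ∀ {v} → v < suc k + n → v ≢ k + n → v < k + n
      below-k+n v<1+k+n = ≤∧≢⇒< (s≤s⁻¹ v<1+k+n)
      edge-sides′ : ∀ {u v} → (u , v) ∈ edges (applyEvent g (depart (k + n))) → Right n k u × v < n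
      edge-sides′ e∈ with ∈-depart-edges⁻ g e∈
      ... | e∈g , u≢k+n with edge-sides B e∈g
      ...   | (n≤u , u<1+k+n) , v<n = (n≤u , below-k+n u<1+k+n u≢k+n) , v<n

  leftArrivals : ℕ → List Event
  leftArrivals zero = []
  leftArrivals (suc n) = leftArrivals n ++ [ arrive n [] ]

  rightArrivals : ℕ → ℕ → List Event
  rightArrivals n zero = []
  rightArrivals n (suc k) = rightArrivals n k ++ [ arrive (k + n) (upTo n) ]

  leftArrivals-biclique : ∀ n → emptyGraph ⊢ leftArrivals n ↝ Biclique n 0
  leftArrivals-biclique zero = reaches tt emptyGraph-biclique
  leftArrivals-biclique (suc n) = ↝-++ (leftArrivals-biclique n) (↝-[ arrive n [] ] ∘ arrive-left-biclique)

  rightArrivals-biclique : ∀ {n g} k → Biclique n 0 g → g ⊢ rightArrivals n k ↝ Biclique n k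
  rightArrivals-biclique zero B = reaches tt B
  rightArrivals-biclique {n} (suc k) B =
    ↝-++ (rightArrivals-biclique k B) (↝-[ arrive (k + n) (upTo n) ] ∘ arrive-right-biclique)

  length-leftArrivals : ∀ n → length (leftArrivals n) ≡ n
  length-leftArrivals zero = refl
  length-leftArrivals (suc n) = trans (length-++-[ arrive n [] ] (leftArrivals n)) (cong suc (length-leftArrivals n))

  length-rightArrivals : ∀ n k → length (rightArrivals n k) ≡ k
  length-rightArrivals n zero = refl
  length-rightArrivals n (suc k) =
    trans (length-++-[ arrive (k + n) (upTo n) ] (rightArrivals n k)) (cong suc (length-rightArrivals n k))

  cycle : ℕ → ℕ → List Event
  cycle n k = arrive (k + n) (upTo n) ∷ arrive (suc k + n) (upTo n) ∷ depart (suc k + n) ∷ depart (k + n) ∷ []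

  cycles : ℕ → ℕ → ℕ → List Event
  cycles n k zero = []
  cycles n k (suc r) = cycle n k ++ cycles n k r

  Oscillation : ℕ → ℕ → (ℕ → Graph) → Set
  Oscillation n k G =
    Biclique n k (G 0) × Biclique n (suc k) (G 1) × Biclique n (suc (suc k)) (G 2) ×
    Biclique n (suc k) (G 3) × Biclique n k (G 4)

  Oscillation-resp : ∀ {n k G H} → (∀ i → G i ≡ H i) → Oscillation n k G → Oscillation n k H
  Oscillation-resp {n} {k} G≗H (B₀ , B₁ , B₂ , B₃ , B₄) =
    subst (Biclique n k) (G≗H 0) B₀ , subst (Biclique n (suc k)) (G≗H 1) B₁ ,
    subst (Biclique n (suc (suc k))) (G≗H 2) B₂ , subst (Biclique n (suc k)) (G≗H 3) B₃ ,
    subst (Biclique n k) (G≗H 4) B₄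

  cycle-oscillation : ∀ {n k g} es → Biclique n k g →
    ValidFrom g (cycle n k) × Oscillation n k (λ i → run g (take i (cycle n k ++ es)))
  cycle-oscillation es B₀ with arrive-right-biclique B₀
  ... | valid₁ , B₁ with arrive-right-biclique B₁
  ... | valid₂ , B₂ with depart-right-biclique B₂
  ... | valid₃ , B₃ with depart-right-biclique B₃
  ... | valid₄ , B₄ = (valid₁ , valid₂ , valid₃ , valid₄ , tt) , B₀ , B₁ , B₂ , B₃ , B₄

  cycle-biclique : ∀ {n k g} → Biclique n k g → g ⊢ cycle n k ↝ Biclique n k
  cycle-biclique B with cycle-oscillation [] B
  ... | valid-cycle , _ , _ , _ , _ , B′ = reaches valid-cycle B′

  cycles-biclique : ∀ {n k g} r → Biclique n k g → g ⊢ cycles n k r ↝ Biclique n k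
  cycles-biclique zero B = reaches tt B
  cycles-biclique (suc r) B = ↝-++ (cycle-biclique B) (cycles-biclique r)

  cycles-+ : ∀ n k j r → cycles n k (j + r) ≡ cycles n k j ++ cycles n k r
  cycles-+ n k zero r = refl
  cycles-+ n k (suc j) r =
    trans (cong (cycle n k ++_) (cycles-+ n k j r)) (sym (++-assoc (cycle n k) (cycles n k j) (cycles n k r)))

  length-cycles : ∀ n k r → length (cycles n k r) ≡ r * 4
  length-cycles n k zero = refl
  length-cycles n k (suc r) = cong (4 +_) (length-cycles n k r)

  cycles-oscillation : ∀ {n k} xs → emptyGraph ⊢ xs ↝ Biclique n k → ∀ j r →
    Oscillation n k (λ i → graphAt (xs ++ cycles n k (j + suc r)) (i + (j * 4 + length xs)))
  cycles-oscillation {n} {k} xs (reaches _ B) j r =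
    Oscillation-resp graph≡ (proj₂ (cycle-oscillation (cycles n k r) (reached (cycles-biclique j B))))
    where
      ys zs : List Event
      ys = xs ++ cycles n k j
      zs = cycles n k (suc r)
      instance≡ : xs ++ cycles n k (j + suc r) ≡ ys ++ zs
      instance≡ = trans (cong (xs ++_) (cycles-+ n k j (suc r))) (sym (++-assoc xs _ _))
      start≡ : j * 4 + length xs ≡ length ys
      start≡ = trans (+-comm (j * 4) (length xs))
                 (sym (trans (length-++ xs) (cong (length xs +_) (length-cycles n k j))))
      graph≡ : ∀ i → run (run (run emptyGraph xs) (cycles n k j)) (take i zs)
                   ≡ graphAt (xs ++ cycles n k (j + suc r)) (i + (j * 4 + length xs))
      graph≡ i = begin
        run (run (run emptyGraph xs) (cycles n k j)) (take i zs)
          ≡⟨ cong (λ g → run g (take i zs)) (run-++ emptyGraph xs (cycles n k j)) ⟨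
        run (run emptyGraph ys) (take i zs)
          ≡⟨ graphAt-++ ys zs i ⟨
        graphAt (ys ++ zs) (i + length ys)
          ≡⟨ cong₂ graphAt instance≡ (cong (i +_) start≡) ⟨
        graphAt (xs ++ cycles n k (j + suc r)) (i + (j * 4 + length xs)) ∎
        where open ≡-Reasoning

  IsMaximumUpTo : ℕ → Graph → List ℕ → Set
  IsMaximumUpTo N g S =
    IsIndependentSet g S × (∀ S′ → IsIndependentSet g S′ → length S′ ≤ N → length S′ ≤ length S)

  rightVertices : ℕ → ℕ → List ℕ
  rightVertices n k = applyUpTo (_+ n) k

  ∈-rightVertices⁻ : ∀ {n k v} → v ∈ rightVertices n k → Right n k v
  ∈-rightVertices⁻ {n} v∈ with ∈-applyUpTo⁻ (_+ n) v∈
  ... | i , i<k , refl = m≤n+m n i , +-monoˡ-< n i<k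

  ∈-rightVertices⁺ : ∀ {n k v} → Right n k v → v ∈ rightVertices n k
  ∈-rightVertices⁺ {n} {k} {v} (n≤v , v<k+n) =
    subst (_∈ rightVertices n k) v≡
      (∈-applyUpTo⁺ (_+ n) (+-cancelʳ-< n (v ∸ n) k (subst (_< k + n) (sym v≡) v<k+n)))
    where
      v≡ : v ∸ n + n ≡ v
      v≡ = m∸n+n≡m n≤v

  rightVertices-unique : ∀ n k → Unique (rightVertices n k)
  rightVertices-unique n k = applyUpTo⁺₁ (_+ n) k (λ i<j _ → <⇒≢ (+-monoˡ-< n i<j))

  length-≤-left : ∀ {n S} → Unique S → All (_< n) S → length S ≤ n
  length-≤-left {n} {S} unique-S S<n =
    subst (length S ≤_) (length-upTo n) (Unique⇒length-mono unique-S (∈-upTo⁺ ∘ All.lookup S<n))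

  module _ {n k g} (B : Biclique n k g) where

    independent-one-sided : ∀ {S} → IsIndependentSet g S → All (_< n) S ⊎ All (n ≤_) S
    independent-one-sided {S} (_ , S⊆g , no-edge) with all? (_<? n) S
    ... | yes S<n = inj₁ S<n
    ... | no ¬S<n with find (¬All⇒Any¬ (_<? n) S ¬S<n)
    ...   | u , u∈S , u≮n = inj₂ (All.tabulate n≤)
      where
        u-right : Right n k u
        u-right = ≮⇒≥ u≮n , vertex⇒< B (All.lookup S⊆g u∈S)
        n≤ : ∀ {v} → v ∈ S → n ≤ v
        n≤ {v} v∈S with v <? n
        ... | yes v<n = ⊥-elim (no-edge u v u∈S v∈S (right-left-edge B u-right v<n))
        ... | no v≮n = ≮⇒≥ v≮n

    left-independent : IsIndependentSet g (upTo n)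
    left-independent =
      upTo⁺ n ,
      All.tabulate (λ v∈ → <⇒vertex B (≤-trans (∈-upTo⁻ v∈) (m≤n+m n k))) ,
      λ u v u∈ _ e∈ → <⇒≱ (∈-upTo⁻ u∈) (proj₁ (proj₁ (edge-sides B e∈)))

    right-independent : IsIndependentSet g (rightVertices n k)
    right-independent =
      rightVertices-unique n k ,
      All.tabulate (λ v∈ → <⇒vertex B (proj₂ (∈-rightVertices⁻ v∈))) ,
      λ u v _ v∈ e∈ → <⇒≱ (proj₂ (edge-sides B e∈)) (proj₁ (∈-rightVertices⁻ v∈))

    length-≤-right : ∀ {S} → IsIndependentSet g S → All (n ≤_) S → length S ≤ k
    length-≤-right {S} (unique-S , S⊆g , _) n≤S =
      subst (length S ≤_) (length-applyUpTo (_+ n) k)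
        (Unique⇒length-mono unique-S λ v∈S →
          ∈-rightVertices⁺ (All.lookup n≤S v∈S , vertex⇒< B (All.lookup S⊆g v∈S)))

    module _ {N S} (max : IsMaximumUpTo N g S) where

      maximum-≥-left : n ≤ N → n ≤ length S
      maximum-≥-left n≤N = subst (_≤ length S) (length-upTo n)
        (proj₂ max (upTo n) left-independent (subst (_≤ N) (sym (length-upTo n)) n≤N))

      maximum-≥-right : k ≤ N → k ≤ length S
      maximum-≥-right k≤N = subst (_≤ length S) (length-applyUpTo (_+ n) k)
        (proj₂ max (rightVertices n k) right-independent (subst (_≤ N) (sym (length-applyUpTo (_+ n) k)) k≤N))

      maximum-balanced : n ≤ N → (All (_< n) S ⊎ All (n ≤_) S) × n ≤ length S
      maximum-balanced n≤N = independent-one-sided (proj₁ max) , maximum-≥-left n≤N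

      maximum-left : k < n → n ≤ N → All (_< n) S × n ≤ length S
      maximum-left k<n n≤N with independent-one-sided (proj₁ max)
      ... | inj₁ S<n = S<n , maximum-≥-left n≤N
      ... | inj₂ n≤S =
        ⊥-elim (<⇒≱ (≤-<-trans (length-≤-right (proj₁ max) n≤S) k<n) (maximum-≥-left n≤N))

      maximum-right : n < k → k ≤ N → All (n ≤_) S × k ≤ length S
      maximum-right n<k k≤N with independent-one-sided (proj₁ max)
      ... | inj₂ n≤S = n≤S , maximum-≥-right k≤N
      ... | inj₁ S<n =
        ⊥-elim (<⇒≱ (≤-<-trans (length-≤-left (proj₁ (proj₁ max)) S<n) n<k) (maximum-≥-right k≤N))

  All-disjoint : ∀ {P Q : ℕ → Set} {X Z} → (∀ {v} → P v → ¬ Q v) → All P X → All Q Z →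
    ∀ {x} → x ∈ X → x ∉ Z
  All-disjoint P⇒¬Q P-X Q-Z x∈X x∈Z = P⇒¬Q (All.lookup P-X x∈X) (All.lookup Q-Z x∈Z)

  -- Whichever side S₁ lies on, one of the two steps drops a whole set of size ≥ m.
  switch-cost : ∀ {P Q : ℕ → Set} {m S₀ S₁ S₂} → (∀ {v} → P v → ¬ Q v) →
    All P S₀ × m ≤ length S₀ → (All P S₁ ⊎ All Q S₁) × m ≤ length S₁ → All Q S₂ →
    m ≤ dropped S₀ S₁ + dropped S₁ S₂
  switch-cost {S₀ = S₀} {S₁} {S₂} P⇒¬Q _ (inj₁ P-S₁ , m≤S₁) Q-S₂ = begin
    _                             ≤⟨ m≤S₁ ⟩
    length S₁                     ≡⟨ dropped-disjoint (All-disjoint P⇒¬Q P-S₁ Q-S₂) ⟨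
    dropped S₁ S₂                 ≤⟨ m≤n+m _ _ ⟩
    dropped S₀ S₁ + dropped S₁ S₂ ∎
    where open ≤-Reasoning
  switch-cost {S₀ = S₀} {S₁} {S₂} P⇒¬Q (P-S₀ , m≤S₀) (inj₂ Q-S₁ , _) _ = begin
    _                             ≤⟨ m≤S₀ ⟩
    length S₀                     ≡⟨ dropped-disjoint (All-disjoint P⇒¬Q P-S₀ Q-S₁) ⟨
    dropped S₀ S₁                 ≤⟨ m≤m+n _ _ ⟩
    dropped S₀ S₁ + dropped S₁ S₂ ∎
    where open ≤-Reasoning

  oscillation-dropped : ∀ {m} {G : ℕ → Graph} {S : ℕ → List ℕ} → Oscillation (suc m) m G →
    (∀ i → i ≤ 4 → IsMaximumUpTo (suc (suc m)) (G i) (S i)) →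
    suc m + suc m ≤ (dropped (S 0) (S 1) + dropped (S 1) (S 2)) + (dropped (S 2) (S 3) + dropped (S 3) (S 4))
  oscillation-dropped {m} {S = S} (B₀ , B₁ , B₂ , B₃ , B₄) max = +-mono-≤
    (switch-cost <⇒≱ (maximum-left B₀ (max 0 z≤n) ≤-refl (n≤1+n _))
      (maximum-balanced B₁ (max 1 (s≤s z≤n)) (n≤1+n _)) (proj₁ right₂))
    (switch-cost (flip <⇒≱) (map₂ (≤-trans (n≤1+n _)) right₂)
      (map₁ swap (maximum-balanced B₃ (max 3 (s≤s (s≤s (s≤s z≤n)))) (n≤1+n _)))
      (proj₁ (maximum-left B₄ (max 4 ≤-refl) ≤-refl (n≤1+n _))))
    where
      right₂ : All (suc m ≤_) (S 2) × suc (suc m) ≤ length (S 2)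
      right₂ = maximum-right B₂ (max 2 (s≤s (s≤s z≤n))) ≤-refl ≤-refl

  totalMigrationCost-cycle : ∀ A I t →
    totalMigrationCost A I t +
      ((droppedAt A I t + droppedAt A I (1 + t)) + (droppedAt A I (2 + t) + droppedAt A I (3 + t)))
    ≤ totalMigrationCost A I (4 + t)
  totalMigrationCost-cycle A I t = begin
    C + ((d₀ + d₁) + (d₂ + d₃))    ≡⟨ regroup C d₀ d₁ d₂ d₃ ⟩
    (((C + d₀) + d₁) + d₂) + d₃    ≤⟨ +-mono-≤ (+-mono-≤ (+-mono-≤ (+-monoʳ-≤ C (cost t))
                                         (cost (1 + t))) (cost (2 + t))) (cost (3 + t)) ⟩
    totalMigrationCost A I (4 + t) ∎
    where
      open ≤-Reasoning
      C d₀ d₁ d₂ d₃ : ℕ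
      C = totalMigrationCost A I t
      d₀ = droppedAt A I t
      d₁ = droppedAt A I (1 + t)
      d₂ = droppedAt A I (2 + t)
      d₃ = droppedAt A I (3 + t)
      cost : ∀ t → droppedAt A I t ≤ migrationCost A I (suc t)
      cost = droppedAt≤migrationCost A I
      regroup : ∀ a b c d e → a + ((b + c) + (d + e)) ≡ (((a + b) + c) + d) + e
      regroup = solve-∀

  hardPrefix : ℕ → List Event
  hardPrefix m = leftArrivals (suc m) ++ rightArrivals (suc m) m

  hardInstance : ℕ → Instance
  hardInstance m = hardPrefix m ++ cycles (suc m) m (suc m)

  hardPrefix-biclique : ∀ m → emptyGraph ⊢ hardPrefix m ↝ Biclique (suc m) m
  hardPrefix-biclique m = ↝-++ (leftArrivals-biclique (suc m)) (rightArrivals-biclique m)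

  hardInstance-valid : ∀ m → ValidInstance (hardInstance m)
  hardInstance-valid m = valid (↝-++ (hardPrefix-biclique m) (cycles-biclique (suc m)))

  length-hardPrefix : ∀ m → length (hardPrefix m) ≡ suc m + m
  length-hardPrefix m = trans (length-++ (leftArrivals (suc m)))
    (cong₂ _+_ (length-leftArrivals (suc m)) (length-rightArrivals (suc m) m))

  length-hardInstance : ∀ m → length (hardInstance m) ≡ suc m * 4 + length (hardPrefix m)
  length-hardInstance m = begin
    length (hardPrefix m ++ cycles (suc m) m (suc m))       ≡⟨ length-++ (hardPrefix m) ⟩
    length (hardPrefix m) + length (cycles (suc m) m (suc m)) ≡⟨ cong (length (hardPrefix m) +_) (length-cycles (suc m) m (suc m)) ⟩
    length (hardPrefix m) + suc m * 4                        ≡⟨ +-comm (length (hardPrefix m)) (suc m * 4) ⟩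
    suc m * 4 + length (hardPrefix m)                        ∎
    where open ≡-Reasoning

  hardInstance-oscillation : ∀ m j → j ≤ m →
    Oscillation (suc m) m (λ i → graphAt (hardInstance m) (i + (j * 4 + length (hardPrefix m))))
  hardInstance-oscillation m j j≤m =
    subst (λ r → Oscillation (suc m) m λ i →
                   graphAt (hardPrefix m ++ cycles (suc m) m r) (i + (j * 4 + length (hardPrefix m))))
      (trans (+-suc j (m ∸ j)) (cong suc (m+[n∸m]≡n j≤m)))
      (cycles-oscillation (hardPrefix m) (hardPrefix-biclique m) j (m ∸ j))

  module _ {m A} (max : ∀ t → t ≤ length (hardInstance m) →
                       IsMaximumUpTo (suc (suc m)) (graphAt (hardInstance m) t) (outputAt A (hardInstance m) t)) where

    hardInstance-cost : ∀ j → j ≤ suc m →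
      j * (suc m + suc m) ≤ totalMigrationCost A (hardInstance m) (j * 4 + length (hardPrefix m))
    hardInstance-cost zero _ = z≤n
    hardInstance-cost (suc j) j<1+m = begin
      (suc m + suc m) + j * (suc m + suc m)   ≡⟨ +-comm (suc m + suc m) _ ⟩
      j * (suc m + suc m) + (suc m + suc m)   ≤⟨ +-mono-≤ (hardInstance-cost j (<⇒≤ j<1+m))
                                                   (oscillation-dropped (hardInstance-oscillation m j (s≤s⁻¹ j<1+m)) max-cycle) ⟩
      totalMigrationCost A (hardInstance m) t + _
                                              ≤⟨ totalMigrationCost-cycle A (hardInstance m) t ⟩
      totalMigrationCost A (hardInstance m) (suc j * 4 + length (hardPrefix m)) ∎
      where
        open ≤-Reasoning
        t : ℕ
        t = j * 4 + length (hardPrefix m)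
        max-cycle : ∀ i → i ≤ 4 →
          IsMaximumUpTo (suc (suc m)) (graphAt (hardInstance m) (i + t)) (outputAt A (hardInstance m) (i + t))
        max-cycle i i≤4 = max (i + t) (begin
          i + t                              ≤⟨ +-monoˡ-≤ t i≤4 ⟩
          suc j * 4 + length (hardPrefix m)  ≤⟨ +-monoˡ-≤ _ (*-monoˡ-≤ 4 j<1+m) ⟩
          suc m * 4 + length (hardPrefix m)  ≡⟨ length-hardInstance m ⟨
          length (hardInstance m)            ∎)

    hardInstance-total-cost : suc m * (suc m + suc m) ≤ totalMigrationCost A (hardInstance m) (length (hardInstance m))
    hardInstance-total-cost = subst (λ t → suc m * (suc m + suc m) ≤ totalMigrationCost A (hardInstance m) t)
      (sym (length-hardInstance m)) (hardInstance-cost (suc m) ≤-refl)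

  cancel-small-error : ∀ {D P k s} → P * k < D → D * k ≤ s * D + P * k → k ≤ s
  cancel-small-error {D} {P} {k} {s} Pk<D Dk≤sD+Pk = s≤s⁻¹ (*-cancelˡ-< D k (suc s) (begin-strict
    D * k        ≤⟨ Dk≤sD+Pk ⟩
    s * D + P * k <⟨ +-monoʳ-< (s * D) Pk<D ⟩
    s * D + D    ≡⟨ +-comm (s * D) D ⟩
    suc s * D    ≡⟨ *-comm (suc s) D ⟩
    D * suc s    ∎))
    where open ≤-Reasoning

  length-hardInstance-≤ : ∀ m → length (hardInstance m) ≤ suc m * 6
  length-hardInstance-≤ m = begin
    length (hardInstance m)             ≡⟨ length-hardInstance m ⟩
    suc m * 4 + length (hardPrefix m)   ≡⟨ cong (suc m * 4 +_) (length-hardPrefix m) ⟩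
    suc m * 4 + (suc m + m)             ≤⟨ +-monoʳ-≤ (suc m * 4) (+-monoʳ-≤ (suc m) (n≤1+n m)) ⟩
    suc m * 4 + (suc m + suc m)         ≡⟨ regroup (suc m) ⟩
    suc m * 6                           ∎
    where
      open ≤-Reasoning
      regroup : ∀ n → n * 4 + (n + n) ≡ n * 6
      regroup = solve-∀

  migration-arithmetic : ∀ {m P d t C} → 1 ≤ m → suc d ≤ suc (suc (suc m)) * P →
    t ≤ suc m * 6 → suc m * (suc m + suc m) ≤ C → t * suc d ≤ (P * C) * 6
  migration-arithmetic {m} {P} {d} {t} {C} 1≤m D≤ t≤ C≥ = begin
    t * suc d                            ≤⟨ *-mono-≤ t≤ D≤ ⟩
    (n * 6) * ((2 + n) * P)              ≤⟨ *-monoʳ-≤ (n * 6) (*-monoˡ-≤ P (+-monoˡ-≤ n (s≤s 1≤m))) ⟩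
    (n * 6) * ((n + n) * P)              ≡⟨ regroup n P ⟩
    (P * (n * (n + n))) * 6              ≤⟨ *-monoˡ-≤ 6 (*-monoʳ-≤ P C≥) ⟩
    (P * C) * 6                          ∎
    where
      open ≤-Reasoning
      n : ℕ
      n = suc m
      regroup : ∀ n P → (n * 6) * ((n + n) * P) ≡ (P * (n * (n + n))) * 6
      regroup = solve-∀

  hardInstance-size : ∀ p d → suc p * 4 < suc d →
    Σ ℕ λ m → 1 ≤ m × suc (suc m) * suc p ≤ d × suc d ≤ suc (suc (suc m)) * suc p
  hardInstance-size p d 4P<D = fit (d / suc p) quotient-large (m/n*n≤m d (suc p)) D≤[1+q]P
    where
      D≤[1+q]P : suc d ≤ suc (d / suc p) * suc p
      D≤[1+q]P = begin
        suc d                                   ≡⟨ cong suc (m≡m%n+[m/n]*n d (suc p)) ⟩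
        suc (d % suc p + d / suc p * suc p)     ≤⟨ +-monoˡ-≤ (d / suc p * suc p) (m%n<n d (suc p)) ⟩
        suc p + d / suc p * suc p               ∎
        where open ≤-Reasoning
      quotient-large : 4 < suc (d / suc p)
      quotient-large = *-cancelʳ-< (suc p) 4 (suc (d / suc p))
        (<-≤-trans (subst (_< suc d) (*-comm (suc p) 4) 4P<D) D≤[1+q]P)
      fit : ∀ q → 4 < suc q → q * suc p ≤ d → suc d ≤ suc q * suc p →
        Σ ℕ λ m → 1 ≤ m × suc (suc m) * suc p ≤ d × suc d ≤ suc (suc (suc m)) * suc p
      fit (suc (suc m)) (s≤s (s≤s (s≤s (s≤s (s≤s _))))) qP≤d D≤ = m , s≤s z≤n , qP≤d , D≤

open Construction
  using (IsMaximumUpTo; cancel-small-error; hardInstance; hardInstance-valid; hardInstance-size;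
         hardInstance-total-cost; length-hardInstance; length-hardInstance-≤; migration-arithmetic)
open import Data.Nat using (ℕ; zero; suc; z≤n; s≤s)
import Data.Nat as ℕ
import Data.Nat.Properties as ℕ
open import Data.Nat.Coprimality using (Coprime; 1-coprimeTo)
import Data.Nat.Coprimality as Coprimality
open import Data.Integer as ℤ using (ℤ; +_; -[1+_]; +≤+; +<+)
import Data.Integer.Properties as ℤ
open import Data.Integer.Tactic.RingSolver using (solve-∀)
open import Data.List using (List; length)
open import Data.Product using (Σ; _×_; _,_)
open import Data.Rational using (ℚ; mkℚ; _/_; *<*; toℚᵘ; 0ℚ; 1ℚ; _<_; _-_; _*_; -_; _≤_)
import Data.Rational.Properties as ℚ
open import Data.Rational.Unnormalised as ℚᵘ using (mkℚᵘ)
import Data.Rational.Unnormalised.Properties as ℚᵘ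
open import Relation.Binary.PropositionalEquality

toℚᵘ-toℚ : ∀ k → toℚᵘ (toℚ k) ≡ mkℚᵘ (+ k) 0
toℚᵘ-toℚ k = cong toℚᵘ (ℚ.normalize-coprime {k} {0} (Coprimality.sym (1-coprimeTo k)))

toℚᵘ-*-toℚ : ∀ q k → toℚᵘ (q * toℚ k) ℚᵘ.≃ toℚᵘ q ℚᵘ.* mkℚᵘ (+ k) 0
toℚᵘ-*-toℚ q k =
  ℚᵘ.≃-trans (ℚ.toℚᵘ-homo-* q (toℚ k)) (ℚᵘ.*-cong (ℚᵘ.≃-refl {toℚᵘ q}) (ℚᵘ.≃-reflexive (toℚᵘ-toℚ k)))

clear-near-optimal : ∀ p d .(c : Coprime (suc p) (suc d)) k s →
  (1ℚ - mkℚ (+ suc p) d c) * toℚ k ≤ toℚ s → suc d ℕ.* k ℕ.≤ s ℕ.* suc d ℕ.+ suc p ℕ.* k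
clear-near-optimal p d c k s h = ℤ.drop‿+≤+ (begin
  + (suc d ℕ.* k)
    ≡⟨ trans (ℤ.pos-* (suc d) k) (expand (+ suc d) (+ suc p) (+ k)) ⟩
  ((+ 1 ℤ.* + suc d ℤ.+ -[1+ p ] ℤ.* + 1) ℤ.* + k) ℤ.* + 1 ℤ.+ Pk
    ≤⟨ ℤ.+-monoˡ-≤ Pk cleared ⟩
  + s ℤ.* + ((1 ℕ.* suc d) ℕ.* 1) ℤ.+ Pk
    ≡⟨ cong (λ x → + s ℤ.* + x ℤ.+ Pk) (trans (ℕ.*-identityʳ (1 ℕ.* suc d)) (ℕ.*-identityˡ (suc d))) ⟩
  + s ℤ.* + suc d ℤ.+ Pk
    ≡⟨ cong₂ ℤ._+_ (ℤ.pos-* s (suc d)) (ℤ.pos-* (suc p) k) ⟨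
  + (s ℕ.* suc d ℕ.+ suc p ℕ.* k) ∎)
  where
    open ℤ.≤-Reasoning
    Pk : ℤ
    Pk = + suc p ℤ.* + k
    expand : ∀ D P K → D ℤ.* K ≡ ((+ 1 ℤ.* D ℤ.+ (ℤ.- P) ℤ.* + 1) ℤ.* K) ℤ.* + 1 ℤ.+ P ℤ.* K
    expand = solve-∀
    cleared : ((+ 1 ℤ.* + suc d ℤ.+ -[1+ p ] ℤ.* + 1) ℤ.* + k) ℤ.* + 1 ℤ.≤ + s ℤ.* + ((1 ℕ.* suc d) ℕ.* 1)
    cleared = ℚᵘ.drop-*≤* (ℚᵘ.≤-respʳ-≃ (ℚᵘ.≃-reflexive (toℚᵘ-toℚ s))
      (ℚᵘ.≤-respˡ-≃ (ℚᵘ.≃-trans (toℚᵘ-*-toℚ (1ℚ - mkℚ (+ suc p) d c) k)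
                                 (ℚᵘ.*-cong (ℚ.toℚᵘ-homo-+ 1ℚ (- mkℚ (+ suc p) d c)) ℚᵘ.≃-refl))
        (ℚ.toℚᵘ-mono-≤ h)))

clear-migration-bound : ∀ p d .(c : Coprime (suc p) (suc d)) t C →
  t ℕ.* suc d ℕ.≤ (suc p ℕ.* C) ℕ.* 6 → (+ 1 / 6) * toℚ t ≤ mkℚ (+ suc p) d c * toℚ C
clear-migration-bound p d c t C tD≤PC6 = ℚ.toℚᵘ-cancel-≤
  (ℚᵘ.≤-respˡ-≃ (ℚᵘ.≃-sym (toℚᵘ-*-toℚ (+ 1 / 6) t))
    (ℚᵘ.≤-respʳ-≃ (ℚᵘ.≃-sym (toℚᵘ-*-toℚ (mkℚ (+ suc p) d c) C)) (ℚᵘ.*≤* cleared)))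
  where
    cleared : (+ 1 ℤ.* + t) ℤ.* + (suc d ℕ.* 1) ℤ.≤ (+ suc p ℤ.* + C) ℤ.* + (6 ℕ.* 1)
    cleared = begin
      (+ 1 ℤ.* + t) ℤ.* + (suc d ℕ.* 1)
                                        ≡⟨ cong₂ ℤ._*_ (ℤ.*-identityˡ (+ t)) (cong +_ (ℕ.*-identityʳ (suc d))) ⟩
      + t ℤ.* + suc d                   ≡⟨ ℤ.pos-* t (suc d) ⟨
      + (t ℕ.* suc d)                   ≤⟨ +≤+ tD≤PC6 ⟩
      + ((suc p ℕ.* C) ℕ.* 6)           ≡⟨ ℤ.pos-* (suc p ℕ.* C) 6 ⟩
      + (suc p ℕ.* C) ℤ.* + 6           ≡⟨ cong (ℤ._* + 6) (ℤ.pos-* (suc p) C) ⟩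
      (+ suc p ℤ.* + C) ℤ.* + 6         ∎
      where open ℤ.≤-Reasoning

clear-quarter-bound : ∀ p d .(c : Coprime (suc p) (suc d)) →
  mkℚ (+ suc p) d c < + 1 / 4 → suc p ℕ.* 4 ℕ.< suc d
clear-quarter-bound p d c (*<* P4<D) =
  ℤ.drop‿+<+ (subst₂ ℤ._<_ (sym (ℤ.pos-* (suc p) 4)) (ℤ.*-identityˡ (+ suc d)) P4<D)

IsNearOptimal : ℚ → Graph → List ℕ → Set
IsNearOptimal ε g S =
  IsIndependentSet g S ×
  ((S′ : List ℕ) → IsIndependentSet g S′ → (1ℚ - ε) * toℚ (length S′) ≤ toℚ (length S))

near-optimal⇒maximumUpTo : ∀ {p d N g S} .{c : Coprime (suc p) (suc d)} → N ℕ.* suc p ℕ.≤ d →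
  IsNearOptimal (mkℚ (+ suc p) d c) g S → IsMaximumUpTo N g S
near-optimal⇒maximumUpTo {p} {d} {N} {S = S} {c} NP≤d (independent , near) =
  independent , λ S′ independent′ S′≤N → cancel-small-error {P = suc p}
    (s≤s (ℕ.≤-trans (ℕ.*-monoʳ-≤ (suc p) {length S′} S′≤N) (subst (ℕ._≤ d) (ℕ.*-comm N (suc p)) NP≤d)))
    (clear-near-optimal p d c (length S′) (length S) (near S′ independent′))

hardInstance-lower-bound : ∀ p d .(c : Coprime (suc p) (suc d)) → mkℚ (+ suc p) d c < + 1 / 4 →
  Σ Instance λ I → ValidInstance I ×
    ((A : OnlineAlgorithm) →
      ((t : ℕ) → t ℕ.≤ length I → IsNearOptimal (mkℚ (+ suc p) d c) (graphAt I t) (outputAt A I t)) →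
      Σ ℕ λ t → 1 ℕ.≤ t × t ℕ.≤ length I ×
        (+ 1 / 6) * toℚ t ≤ mkℚ (+ suc p) d c * toℚ (totalMigrationCost A I t))
hardInstance-lower-bound p d c ε<¼ with hardInstance-size p d (clear-quarter-bound p d c ε<¼)
... | m , 1≤m , NP≤d , D≤ = hardInstance m , hardInstance-valid m , λ A near-optimal →
  length (hardInstance m) , subst (1 ℕ.≤_) (sym (length-hardInstance m)) (s≤s z≤n) , ℕ.≤-refl ,
  clear-migration-bound p d c (length (hardInstance m)) (totalMigrationCost A (hardInstance m) (length (hardInstance m)))
    (migration-arithmetic {P = suc p} 1≤m D≤ (length-hardInstance-≤ m)
      (hardInstance-total-cost {m} {A} λ t t≤ → near-optimal⇒maximumUpTo {c = c} NP≤d (near-optimal t t≤)))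

theorem20 : Σ ℚ λ c → Σ ℚ λ ε₀ → (0ℚ < c) × (0ℚ < ε₀) ×
    ((ε : ℚ) → 0ℚ < ε → ε < ε₀ →
      Σ Instance λ I → ValidInstance I ×
        ((A : OnlineAlgorithm) →
          ((t : ℕ) → t Data.Nat.≤ length I →
            IsIndependentSet (graphAt I t) (outputAt A I t) ×
            ((S' : List ℕ) → IsIndependentSet (graphAt I t) S' →
              ((1ℚ - ε) * toℚ (length S')) Data.Rational.≤ toℚ (length (outputAt A I t)))) →
          Σ ℕ λ t → (1 Data.Nat.≤ t) × (t Data.Nat.≤ length I) ×
            ((c * toℚ t) Data.Rational.≤ (ε * toℚ (totalMigrationCost A I t)))))
theorem20 = + 1 / 6 , + 1 / 4 , *<* (+<+ (s≤s z≤n)) , *<* (+<+ (s≤s z≤n)) , λ where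
  (mkℚ (+ suc p) d c) _ ε<¼ → hardInstance-lower-bound p d c ε<¼
  (mkℚ (+ zero) _ _) (*<* (+<+ ())) _
  (mkℚ -[1+ _ ] _ _) (*<* ()) _
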